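{- Let $G$ be a connected graph of order $n$ and size $m$, where $n-1 \leq m \leq \binom{n-1}{2}$. Then \[ \rho(G) \leq \frac{n+2}{2} - \frac{m}{n-1}, \] with equality if and only if $G=PK_{n,m,1}$.
   Context: All graphs are finite and simple. For a connected graph $G$ of order $n\ge 2$ and a vertex $v$, $\overline{\sigma}_G(v)=\frac{1}{n-1}\sum_{w\in V(G)} d_G(v,w)$; the remoteness is $\rho(G)=\max_{v}\overline{\sigma}_G(v)$. Size means number of edges. For disjoint graphs $G_1,\dots,G_k$, the sequential sum $G_1+\cdots+G_k$ is obtained from their disjoint union by joining every vertex of $G_i$ to every vertex of $G_{i+1}$ for each $i$; $[K_1]^{\ell}$ denotes $\ell$ consecutive copies of $K_1$ in such a sum. A $1$-connected path-complete graph is a graph $K_1 + [K_1]^{\ell} + K_a + K_b$ with $\ell,a,b$ positive integers. $PK_{n,m,1}$ denotes the $1$-connected path-complete graph of order $n$ and size at least $m$ that has minimum size among all such graphs (it is unique). -}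

module Defs where

open import Data.Nat using (ℕ; zero; suc; _+_; _*_; _∸_; _≤_; _<_; _<ᵇ_; _≤ᵇ_)
open import Data.Nat.Combinatorics using (_C_)
open import Data.Bool using (Bool; true; false; _∧_; _∨_; not; if_then_else_)
open import Data.Fin using (Fin; toℕ)
open import Data.Fin.Properties using (_≟_)
open import Data.List using (List; foldr; map)
open import Data.Nat.ListAction using (sum)
open import Data.Bool.ListAction using (any)
open import Data.List.Base using (allFin)
open import Data.Product using (Σ; ∃; _×_; _,_)
open import Data.Integer using (+_)
open import Data.Rational using (ℚ; _/_; _⊔_; 0ℚ)
open import Relation.Nullary.Decidable using (⌊_⌋)
open import Relation.Binary.PropositionalEquality using (_≡_)

record Graph (n : ℕ) : Set where
  field
    adj   : Fin n → Fin n → Bool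
    adj-sym : ∀ i j → adj i j ≡ adj j i
    adj-irrefl : ∀ i → adj i i ≡ false
open Graph public

data Walk {n : ℕ} (G : Graph n) : Fin n → Fin n → ℕ → Set where
  here : ∀ u → Walk G u u 0
  step : ∀ {u v w k} → adj G u v ≡ true → Walk G v w k → Walk G u w (suc k)

Connected : ∀ {n} → Graph n → Set
Connected G = ∀ u v → ∃ λ k → Walk G u v k

size : ∀ {n} → Graph n → ℕ
size {n} G = sum (map (λ i → sum (map (λ j →
  if (toℕ i <ᵇ toℕ j) ∧ adj G i j then 1 else 0) (allFin n))) (allFin n))

reachWithin : ∀ {n} → Graph n → ℕ → Fin n → Fin n → Bool
reachWithin G zero u v = ⌊ u ≟ v ⌋
reachWithin {n} G (suc k) u v =
  reachWithin G k u v ∨ any (λ w → reachWithin G k u w ∧ adj G w v) (allFin n)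

-- Distance: least k with a walk of length ≤ k (searching k = 0 .. bound);
-- for a connected graph on n vertices bound = n suffices.
private
  search : ∀ {n} → Graph n → Fin n → Fin n → ℕ → ℕ → ℕ
  search G u v k zero = k
  search G u v k (suc fuel) =
    if reachWithin G k u v then k else search G u v (suc k) fuel

dist : ∀ {n} → Graph n → Fin n → Fin n → ℕ
dist {n} G u v = search G u v 0 n

transmission : ∀ {n} → Graph n → Fin n → ℕ
transmission {n} G v = sum (map (dist G v) (allFin n))

-- average distance σ̄(v) = σ(v)/(n-1)   (denominator suc (n ∸ 2) = n - 1 for n ≥ 2)
avgDist : ∀ {n} → Graph n → Fin n → ℚ
avgDist {n} G v = (+ transmission G v) / suc (n ∸ 2)

-- remoteness ρ(G) = max_v σ̄(v)  (all values are ≥ 0, so 0 is a neutral start)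
remoteness : ∀ {n} → Graph n → ℚ
remoteness {n} G = foldr _⊔_ 0ℚ (map (avgDist G) (allFin n))

_≅_ : ∀ {n} → Graph n → Graph n → Set
_≅_ {n} G H = Σ (Fin n → Fin n) λ f → Σ (Fin n → Fin n) λ g →
  (∀ i → g (f i) ≡ i) × (∀ j → f (g j) ≡ j) ×
  (∀ i j → adj H (f i) (f j) ≡ adj G i j)

-- The 1-connected path-complete graph K1 + [K1]^ℓ + K_a + K_b on Fin n,
-- where n = 1 + ℓ + a + b.  Vertex i lies in block pos i of the sequential
-- sum: vertices 0..ℓ are the ℓ+1 singleton blocks K1, [K1]^ℓ (positions 0..ℓ),
-- the next a vertices form K_a (position ℓ+1), the remaining b vertices form K_b
-- (position ℓ+2).
private
  pos : ℕ → ℕ → ℕ → ℕ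
  pos ℓ a i = if i ≤ᵇ ℓ then i else (if i ≤ᵇ ℓ + a then suc ℓ else suc (suc ℓ))

  close : ℕ → ℕ → Bool
  close p q = (p ≤ᵇ suc q) ∧ (q ≤ᵇ suc p)

  neq : ∀ {n} → Fin n → Fin n → Bool
  neq i j = not ⌊ i ≟ j ⌋

pathComplete : (n ℓ a b : ℕ) → Graph n
pathComplete n ℓ a b = record
  { adj = λ i j → neq i j ∧ close (pos ℓ a (toℕ i)) (pos ℓ a (toℕ j))
  ; adj-sym = symP
  ; adj-irrefl = irr }
  where
  open import Data.Bool.Properties using (∧-comm)
  open import Relation.Binary.PropositionalEquality using (refl; cong₂; sym)
  open import Relation.Nullary using (yes; no)
  neqSym : ∀ (i j : Fin n) → neq i j ≡ neq j i
  neqSym i j with i ≟ j | j ≟ i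
  ... | yes _ | yes _ = refl
  ... | no _ | no _ = refl
  ... | yes p | no q with q (sym p)
  ... | ()
  neqSym i j | no q | yes p with q (sym p)
  ... | ()
  symP : ∀ (i j : Fin n) → neq i j ∧ close (pos ℓ a (toℕ i)) (pos ℓ a (toℕ j))
         ≡ neq j i ∧ close (pos ℓ a (toℕ j)) (pos ℓ a (toℕ i))
  symP i j = cong₂ _∧_ (neqSym i j)
    (∧-comm (pos ℓ a (toℕ i) ≤ᵇ suc (pos ℓ a (toℕ j))) _)
  irr : ∀ (i : Fin n) → neq i i ∧ close (pos ℓ a (toℕ i)) (pos ℓ a (toℕ i)) ≡ false
  irr i with i ≟ i
  ... | yes _ = refl
  ... | no q with q refl
  ... | ()

IsPCParams : ℕ → ℕ → ℕ → ℕ → Set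
IsPCParams n ℓ a b = (1 ≤ ℓ) × (1 ≤ a) × (1 ≤ b) × (n ≡ 1 + ℓ + a + b)

-- G = PK_{n,m,1}: G is (isomorphic to) a 1-connected path-complete graph of
-- order n and size ≥ m having minimum size among all such graphs.
IsPK1 : (n m : ℕ) → Graph n → Set
IsPK1 n m G = Σ ℕ λ ℓ → Σ ℕ λ a → Σ ℕ λ b →
  IsPCParams n ℓ a b × (m ≤ size (pathComplete n ℓ a b)) ×
  (∀ ℓ′ a′ b′ → IsPCParams n ℓ′ a′ b′ → m ≤ size (pathComplete n ℓ′ a′ b′) →
     size (pathComplete n ℓ a b) ≤ size (pathComplete n ℓ′ a′ b′)) ×
  (G ≅ pathComplete n ℓ a b)

{-# OPTIONS --safe #-}
-- Fix a vertex v and let d = dist v. A vertex w with d w ≥ 1 has at least d w − 1 vertices on the levels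
-- 0, …, d w − 2, so the transmission σ of v is at most F + (n − 1), where F counts the ordered pairs (w, u)
-- with u at least two levels below w. Since adjacent vertices lie on equal or consecutive levels, for each of
-- the n² ordered pairs (w, u) at most one of "u is two levels below w", "w is two levels below u", "w ~ u" and
-- "w = u" holds; hence 2F + 2m + n ≤ n². Adding up gives 2(σ + m) ≤ (n + 2)(n − 1), which is the bound.
-- At equality every non-adjacent pair is two levels apart and the levels below d − 1 of an eccentric vertex
-- are single vertices; m ≤ C(n − 1, 2) forces eccentricity at least 3, and sorting the vertices by level
-- shows G = K₁ + [K₁]^ℓ + K_a + K_b. Conversely, on such a graph the levels of the path-complete structure,
-- seen from its first vertex, satisfy all of these counts with equality.
module Submission where

open import Defs
open import Data.Bool using (Bool; true; false; if_then_else_; _∧_; _∨_; not)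
open import Data.Bool.Properties using (T-≡; T-∧; ∨-zeroʳ; ⇔→≡)
open import Data.Bool.ListAction using (any)
open import Data.Empty using (⊥; ⊥-elim)
open import Data.Fin as Fin using (Fin; toℕ)
import Data.Fin.Permutation as Perm
import Data.Fin.Properties as Fin
open import Data.Integer as ℤ using (+_; +≤+)
import Data.Integer.Properties as ℤ
import Data.Integer.Tactic.RingSolver as ℤ-Solver
import Data.List
open Data.List using (List; []; _∷_; foldr; tabulate; allFin)
open import Data.List.Extrema.Nat using (argmax; f[xs]≤f[argmax])
open import Data.List.Membership.Propositional using (_∈_)
open import Data.List.Membership.Propositional.Properties using (∈-map⁺; ∈-map⁻; ∈-allFin)
open import Data.List.Relation.Unary.All using (All; []; _∷_)
import Data.List.Relation.Unary.All.Properties as All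
open import Data.List.Relation.Unary.Any using (here; there; satisfied)
open import Data.List.Relation.Unary.Any.Properties using (any⁺; any⁻; tabulate⁺; ¬Any[])
open import Data.Nat
  using (ℕ; zero; suc; pred; _+_; _*_; _∸_; _≤_; _<_; z≤n; s≤s; s≤s⁻¹; _≤?_; _<?_; _<ᵇ_; _≤ᵇ_)
open import Data.Nat.Combinatorics using (_C_; nC1≡n; nCk+nC[k+1]≡[n+1]C[k+1])
import Data.Nat.ListAction as ListAction
open import Data.Nat.Properties
open import Data.Nat.Tactic.RingSolver using (solve-∀)
open import Data.Product using (_×_; _,_; ∃; proj₁; proj₂)
open import Data.Rational as ℚ using (ℚ; _/_; _-_; 0ℚ; _⊔_; toℚᵘ) renaming (_≤_ to _≤ℚ_)
open import Data.Rational.Properties as ℚ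
  using (toℚᵘ-fromℚᵘ; toℚᵘ-homo-+; toℚᵘ-homo‿-; toℚᵘ-cancel-≤; toℚᵘ-cong; toℚᵘ-injective)
open import Data.Rational.Unnormalised as ℚᵘ using (ℚᵘ; mkℚᵘ; *≡*; *≤*)
  renaming (_≃_ to _≃ᵘ_; _≤_ to _≤ᵘ_)
import Data.Rational.Unnormalised.Properties as ℚᵘ
open import Algebra.Properties.Group ℚᵘ.+-0-group using (//-rightDividesˡ; //-rightDividesʳ)
open import Data.Sum using (_⊎_; inj₁; inj₂)
open import Function using (_∘_)
open import Function.Bundles using (_⇔_; mk⇔; Equivalence)
open import Relation.Binary using (tri<; tri≈; tri>)
open import Relation.Binary.PropositionalEquality
open import Relation.Nullary using (Dec; yes; no; ¬_; _×-dec_)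
open import Relation.Nullary.Decidable using (⌊_⌋; fromWitness; toWitness; fromWitnessFalse; toWitnessFalse)
open import Relation.Nullary.Reflects using (ofʸ; ofⁿ)
open import Algebra.Properties.Semiring.Sum +-*-semiring
  using (sum; sum-syntax; ∑-comm; ∑-distrib-+; sum-cong-≗; ∑-permute; *-distribˡ-sum)

-- Indicators and finite sums

𝟙 : ∀ {p} {P : Set p} → Dec P → ℕ
𝟙 (yes _) = 1
𝟙 (no _)  = 0

𝟙ᵇ : Bool → ℕ
𝟙ᵇ b = if b then 1 else 0

module _ {p} {P : Set p} where

  𝟙≤1 : (d : Dec P) → 𝟙 d ≤ 1
  𝟙≤1 (yes _) = ≤-refl
  𝟙≤1 (no _)  = z≤n

  𝟙-yes : P → (d : Dec P) → 𝟙 d ≡ 1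
  𝟙-yes _ (yes _) = refl
  𝟙-yes x (no ¬x) = ⊥-elim (¬x x)

  𝟙-no : ¬ P → (d : Dec P) → 𝟙 d ≡ 0
  𝟙-no ¬x (yes x) = ⊥-elim (¬x x)
  𝟙-no _  (no _)  = refl

𝟙-mono : ∀ {p q} {P : Set p} {Q : Set q} → (P → Q) → (d : Dec P) (e : Dec Q) → 𝟙 d ≤ 𝟙 e
𝟙-mono _ (no _)  _       = z≤n
𝟙-mono _ (yes _) (yes _) = ≤-refl
𝟙-mono f (yes x) (no ¬y) = ⊥-elim (¬y (f x))

𝟙-cong : ∀ {p q} {P : Set p} {Q : Set q} → (P → Q) → (Q → P) → (d : Dec P) (e : Dec Q) → 𝟙 d ≡ 𝟙 e
𝟙-cong f g d e = ≤-antisym (𝟙-mono f d e) (𝟙-mono g e d)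

∑-cong : ∀ {n} {f g : Fin n → ℕ} → (∀ i → f i ≡ g i) → sum f ≡ sum g
∑-cong {n} = sum-cong-≗ {n}

∑-mono-≤ : ∀ {n} {f g : Fin n → ℕ} → (∀ i → f i ≤ g i) → sum f ≤ sum g
∑-mono-≤ {zero}  _   = z≤n
∑-mono-≤ {suc n} f≤g = +-mono-≤ (f≤g Fin.zero) (∑-mono-≤ (f≤g ∘ Fin.suc))

∑-mono-< : ∀ {n} {f g : Fin n → ℕ} → (∀ i → f i ≤ g i) → ∀ j → f j < g j → sum f < sum g
∑-mono-< f≤g Fin.zero    f<g = +-mono-<-≤ f<g (∑-mono-≤ (f≤g ∘ Fin.suc))
∑-mono-< f≤g (Fin.suc j) f<g = +-mono-≤-< (f≤g Fin.zero) (∑-mono-< (f≤g ∘ Fin.suc) j f<g)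

∑-mono-≤-tight : ∀ {n} {f g : Fin n → ℕ} → (∀ i → f i ≤ g i) → sum g ≤ sum f → ∀ i → f i ≡ g i
∑-mono-≤-tight {f = f} {g} f≤g ∑g≤∑f i with f i ≟ g i
... | yes fi≡gi = fi≡gi
... | no  fi≢gi = ⊥-elim (<⇒≱ (∑-mono-< f≤g i (≤∧≢⇒< (f≤g i) fi≢gi)) ∑g≤∑f)

term≤∑ : ∀ {n} (f : Fin n → ℕ) i → f i ≤ sum f
term≤∑ f Fin.zero    = m≤m+n _ _
term≤∑ f (Fin.suc i) = ≤-trans (term≤∑ (f ∘ Fin.suc) i) (m≤n+m _ _)

∑-const : ∀ n c → ∑[ i < n ] c ≡ n * c
∑-const zero    c = refl
∑-const (suc n) c = cong (_+_ c) (∑-const n c)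

∑-δ : ∀ {n} (w : Fin n) → ∑[ u < n ] 𝟙 (u Fin.≟ w) ≡ 1
∑-δ {suc n} Fin.zero    = cong suc (begin
  ∑[ u < n ] 𝟙 (Fin.suc u Fin.≟ Fin.zero) ≡⟨ ∑-cong {n} (λ u → 𝟙-no (λ ()) (Fin.suc u Fin.≟ Fin.zero)) ⟩
  ∑[ u < n ] 0                            ≡⟨ trans (∑-const n 0) (*-zeroʳ n) ⟩
  0                                       ∎)
  where open ≡-Reasoning
∑-δ {suc n} (Fin.suc w) = trans (∑-cong {n} λ u →
  𝟙-cong Fin.suc-injective (cong Fin.suc) (Fin.suc u Fin.≟ Fin.suc w) (u Fin.≟ w)) (∑-δ w)

sum-tabulate : ∀ {m n} (g : Fin n → Fin m) (f : Fin m → ℕ) →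
               ListAction.sum (Data.List.map f (tabulate g)) ≡ ∑[ i < n ] f (g i)
sum-tabulate {n = zero}  g f = refl
sum-tabulate {n = suc n} g f = cong (_+_ (f (g Fin.zero))) (sum-tabulate (g ∘ Fin.suc) f)

∑-bijection : ∀ {n} (f g : Fin n → Fin n) → (∀ j → f (g j) ≡ j) → (∀ i → g (f i) ≡ i) →
              (h : Fin n → ℕ) → sum h ≡ sum (h ∘ f)
∑-bijection f g fg gf h = ∑-permute h (Perm.permutation f g fg gf)

true≢false : true ≢ false
true≢false ()

¬-≡-false⇒≡true : ∀ {b} → ¬ b ≡ false → b ≡ true
¬-≡-false⇒≡true {true}  _  = refl
¬-≡-false⇒≡true {false} ¬b = ⊥-elim (¬b refl)

¬-≡-true⇒≡false : ∀ {b} → ¬ b ≡ true → b ≡ false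
¬-≡-true⇒≡false {false} _  = refl
¬-≡-true⇒≡false {true}  ¬b = ⊥-elim (¬b refl)

∧-≡-true : ∀ {a b} → a ∧ b ≡ true → a ≡ true × b ≡ true
∧-≡-true {true} {true} _ = refl , refl

𝟙ᵇ≤1 : ∀ b → 𝟙ᵇ b ≤ 1
𝟙ᵇ≤1 true  = ≤-refl
𝟙ᵇ≤1 false = z≤n

𝟙ᵇ-mono : ∀ {b c} → (b ≡ true → c ≡ true) → 𝟙ᵇ b ≤ 𝟙ᵇ c
𝟙ᵇ-mono {false} _ = z≤n
𝟙ᵇ-mono {true}  b⇒c rewrite b⇒c refl = ≤-refl

any-allFin⁺ : ∀ {n} (p : Fin n → Bool) i → p i ≡ true → any p (allFin n) ≡ true
any-allFin⁺ p i pi = Equivalence.to T-≡ (any⁺ p (tabulate⁺ i (Equivalence.from T-≡ pi)))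

any-allFin⁻ : ∀ {n} (p : Fin n → Bool) → any p (allFin n) ≡ true → ∃ λ i → p i ≡ true
any-allFin⁻ {n} p any≡true with i , pi ← satisfied (any⁻ p (allFin n) (Equivalence.from T-≡ any≡true))
  = i , Equivalence.to T-≡ pi

module _ {n : ℕ} (G : Graph n) where

  private
    forward : Fin n → Fin n → ℕ
    forward i j = 𝟙ᵇ ((toℕ i <ᵇ toℕ j) ∧ adj G i j)

    size-∑ : size G ≡ ∑[ i < n ] ∑[ j < n ] forward i j
    size-∑ = trans (sum-tabulate (λ i → i) (λ i → ListAction.sum (Data.List.map (forward i) (allFin n))))
                   (∑-cong {n} (λ i → sum-tabulate (λ j → j) (forward i)))

    adj≡forward+backward : ∀ i j → 𝟙ᵇ (adj G i j) ≡ forward i j + forward j i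
    adj≡forward+backward i j with toℕ i <ᵇ toℕ j | <ᵇ-reflects-< (toℕ i) (toℕ j)
                                | toℕ j <ᵇ toℕ i | <ᵇ-reflects-< (toℕ j) (toℕ i)
    ... | true  | ofʸ i<j | true  | ofʸ j<i = ⊥-elim (<-asym i<j j<i)
    ... | true  | _       | false | _       = sym (+-identityʳ _)
    ... | false | _       | true  | _       = cong 𝟙ᵇ (adj-sym G i j)
    ... | false | ofⁿ i≮j | false | ofⁿ j≮i
      rewrite Fin.toℕ-injective (≤-antisym (≮⇒≥ j≮i) (≮⇒≥ i≮j)) | adj-irrefl G j = refl

  handshake : ∑[ i < n ] ∑[ j < n ] 𝟙ᵇ (adj G i j) ≡ 2 * size G
  handshake = begin
    ∑[ i < n ] ∑[ j < n ] 𝟙ᵇ (adj G i j)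
      ≡⟨ ∑-cong {n} (λ i → ∑-cong {n} (adj≡forward+backward i)) ⟩
    ∑[ i < n ] ∑[ j < n ] (forward i j + forward j i)
      ≡⟨ ∑-cong {n} (λ i → ∑-distrib-+ (forward i) (λ j → forward j i)) ⟩
    ∑[ i < n ] (∑[ j < n ] forward i j + ∑[ j < n ] forward j i)
      ≡⟨ ∑-distrib-+ (λ i → ∑[ j < n ] forward i j) (λ i → ∑[ j < n ] forward j i) ⟩
    ∑[ i < n ] ∑[ j < n ] forward i j + ∑[ i < n ] ∑[ j < n ] forward j i
      ≡⟨ cong (_+_ (∑[ i < n ] ∑[ j < n ] forward i j)) (∑-comm (λ i j → forward j i)) ⟩
    ∑[ i < n ] ∑[ j < n ] forward i j + ∑[ i < n ] ∑[ j < n ] forward i j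
      ≡⟨ cong₂ _+_ (sym size-∑) (trans (sym size-∑) (sym (+-identityʳ _))) ⟩
    2 * size G ∎
    where open ≡-Reasoning

≅⇒size≡ : ∀ {n} {G H : Graph n} → G ≅ H → size G ≡ size H
≅⇒size≡ {n} {G} {H} (f , g , gf , fg , adj-f) = *-cancelˡ-≡ _ _ 2 (begin
  2 * size G
    ≡⟨ sym (handshake G) ⟩
  ∑[ i < n ] ∑[ j < n ] 𝟙ᵇ (adj G i j)
    ≡⟨ ∑-cong {n} (λ i → ∑-cong {n} (λ j → cong 𝟙ᵇ (sym (adj-f i j)))) ⟩
  ∑[ i < n ] ∑[ j < n ] 𝟙ᵇ (adj H (f i) (f j))
    ≡⟨ ∑-cong {n} (λ i → sym (∑-bijection f g fg gf (λ j → 𝟙ᵇ (adj H (f i) j)))) ⟩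
  ∑[ i < n ] ∑[ j < n ] 𝟙ᵇ (adj H (f i) j)
    ≡⟨ sym (∑-bijection f g fg gf (λ i → ∑[ j < n ] 𝟙ᵇ (adj H i j))) ⟩
  ∑[ i < n ] ∑[ j < n ] 𝟙ᵇ (adj H i j)
    ≡⟨ handshake H ⟩
  2 * size H ∎)
  where open ≡-Reasoning

-- Level functions

Near : ℕ → ℕ → Set
Near p q = p ≤ suc q × q ≤ suc p

far⇒¬Near : ∀ {p q} → q < p ∸ 1 ⊎ p < q ∸ 1 → ¬ Near p q
far⇒¬Near (inj₁ q<p∸1) (p≤1+q , _) = <⇒≱ q<p∸1 (∸-monoˡ-≤ 1 p≤1+q)
far⇒¬Near (inj₂ p<q∸1) (_ , q≤1+p) = <⇒≱ p<q∸1 (∸-monoˡ-≤ 1 q≤1+p)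

x≮x∸1 : ∀ x → ¬ x < x ∸ 1
x≮x∸1 x x<x∸1 = <⇒≱ x<x∸1 (m∸n≤m x 1)

far-asym : ∀ {p q} → q < p ∸ 1 → p < q ∸ 1 → ⊥
far-asym q<p∸1 p<q∸1 = <-asym (<-≤-trans q<p∸1 (m∸n≤m _ 1)) (<-≤-trans p<q∸1 (m∸n≤m _ 1))

¬Near⇒far : ∀ {p q} → ¬ Near p q → q < p ∸ 1 ⊎ p < q ∸ 1
¬Near⇒far {p} {q} ¬near with p ≤? suc q | q ≤? suc p
... | yes p≤1+q | yes q≤1+p = ⊥-elim (¬near (p≤1+q , q≤1+p))
... | no  p≰1+q | _         = inj₁ (∸-monoˡ-< {n = 1} (≰⇒> p≰1+q) (s≤s z≤n))
... | yes _     | no q≰1+p  = inj₂ (∸-monoˡ-< {n = 1} (≰⇒> q≰1+p) (s≤s z≤n))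

module _ {n : ℕ} (φ : Fin n → ℕ) where

  #below : ℕ → ℕ
  #below K = ∑[ u < n ] 𝟙 (φ u <? K)

  #at : ℕ → ℕ
  #at j = ∑[ u < n ] 𝟙 (φ u ≟ j)

  #positive : ℕ
  #positive = ∑[ w < n ] 𝟙 (0 <? φ w)

  farPairs : ℕ
  farPairs = ∑[ w < n ] #below (φ w ∸ 1)

module _ {n : ℕ} (G : Graph n) where

  EdgesNear : (Fin n → ℕ) → Set
  EdgesNear φ = ∀ i j → adj G i j ≡ true → Near (φ i) (φ j)

  NonEdgesFar : (Fin n → ℕ) → Set
  NonEdgesFar φ = ∀ i j → i ≢ j → adj G i j ≡ false → ¬ Near (φ i) (φ j)

  pairWeight : (Fin n → ℕ) → Fin n → Fin n → ℕ
  pairWeight φ w u = 𝟙 (φ u <? φ w ∸ 1) + 𝟙 (φ w <? φ u ∸ 1) + 𝟙ᵇ (adj G w u) + 𝟙 (u Fin.≟ w)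

  ∑∑pairWeight : ∀ φ → ∑[ w < n ] ∑[ u < n ] pairWeight φ w u ≡ 2 * (farPairs φ + size G) + n
  ∑∑pairWeight φ = begin
    ∑[ w < n ] ∑[ u < n ] pairWeight φ w u
      ≡⟨ ∑₂-distrib-+ _ _ ⟩
    ∑[ w < n ] ∑[ u < n ] (far w u + far u w + 𝟙ᵇ (adj G w u)) + ∑[ w < n ] ∑[ u < n ] 𝟙 (u Fin.≟ w)
      ≡⟨ cong₂ _+_ (∑₂-distrib-+ _ _) (trans (∑-cong {n} ∑-δ) (∑-const n 1)) ⟩
    ∑[ w < n ] ∑[ u < n ] (far w u + far u w) + ∑[ w < n ] ∑[ u < n ] 𝟙ᵇ (adj G w u) + n * 1
      ≡⟨ cong₂ (λ x y → x + y + n * 1) (∑₂-distrib-+ _ _) (handshake G) ⟩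
    farPairs φ + ∑[ w < n ] ∑[ u < n ] far u w + 2 * size G + n * 1
      ≡⟨ cong (λ x → farPairs φ + x + 2 * size G + n * 1) (∑-comm {n} {n} (λ w u → far u w)) ⟩
    farPairs φ + farPairs φ + 2 * size G + n * 1
      ≡⟨ arrange (farPairs φ) (size G) n ⟩
    2 * (farPairs φ + size G) + n ∎
    where
    open ≡-Reasoning
    far : Fin n → Fin n → ℕ
    far w u = 𝟙 (φ u <? φ w ∸ 1)
    ∑₂-distrib-+ : (f g : Fin n → Fin n → ℕ) →
      ∑[ w < n ] ∑[ u < n ] (f w u + g w u) ≡ ∑[ w < n ] ∑[ u < n ] f w u + ∑[ w < n ] ∑[ u < n ] g w u
    ∑₂-distrib-+ f g = trans (∑-cong {n} (λ w → ∑-distrib-+ (f w) (g w))) (∑-distrib-+ {n} _ _)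
    arrange : ∀ F m n → F + F + 2 * m + n * 1 ≡ 2 * (F + m) + n
    arrange = solve-∀

  pairWeight≤1 : ∀ {φ} → EdgesNear φ → ∀ w u → pairWeight φ w u ≤ 1
  pairWeight≤1 {φ} near w u with u Fin.≟ w
  ... | yes refl rewrite adj-irrefl G u | 𝟙-no (x≮x∸1 (φ u)) (φ u <? φ u ∸ 1) = ≤-refl
  ... | no u≢w with adj G w u in w~u
  ...   | true  rewrite 𝟙-no (λ lt → far⇒¬Near (inj₁ lt) (near w u w~u)) (φ u <? φ w ∸ 1)
                      | 𝟙-no (λ lt → far⇒¬Near (inj₂ lt) (near w u w~u)) (φ w <? φ u ∸ 1) = ≤-refl
  ...   | false with φ u <? φ w ∸ 1 | φ w <? φ u ∸ 1
  ...     | yes u≪w | yes w≪u = ⊥-elim (far-asym u≪w w≪u)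
  ...     | yes _   | no _    = ≤-refl
  ...     | no _    | yes _   = ≤-refl
  ...     | no _    | no _    = z≤n

  1≤pairWeight : ∀ {φ} → NonEdgesFar φ → ∀ w u → 1 ≤ pairWeight φ w u
  1≤pairWeight {φ} far w u with u Fin.≟ w
  ... | yes _ = m≤n+m 1 _
  ... | no u≢w with adj G w u in w~u
  ...   | true  = ≤-trans (m≤n+m 1 _) (m≤m+n _ 0)
  ...   | false with ¬Near⇒far (far w u (u≢w ∘ sym) w~u)
  ...     | inj₁ u≪w rewrite 𝟙-yes u≪w (φ u <? φ w ∸ 1) = s≤s z≤n
  ...     | inj₂ w≪u rewrite 𝟙-yes w≪u (φ w <? φ u ∸ 1) =
    ≤-trans (m≤n+m 1 _) (≤-trans (m≤m+n _ 0) (m≤m+n _ 0))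

  ∑∑1 : ∑[ w < n ] ∑[ u < n ] 1 ≡ n * n
  ∑∑1 = trans (∑-cong {n} (λ _ → trans (∑-const n 1) (*-identityʳ n))) (∑-const n n)

  farPairs-upper : ∀ {φ} → EdgesNear φ → 2 * (farPairs φ + size G) + n ≤ n * n
  farPairs-upper {φ} near = begin
    2 * (farPairs φ + size G) + n             ≡⟨ sym (∑∑pairWeight φ) ⟩
    ∑[ w < n ] ∑[ u < n ] pairWeight φ w u ≤⟨ ∑-mono-≤ (λ w → ∑-mono-≤ (pairWeight≤1 near w)) ⟩
    ∑[ w < n ] ∑[ u < n ] 1                ≡⟨ ∑∑1 ⟩
    n * n                                    ∎
    where open ≤-Reasoning

  farPairs-lower : ∀ {φ} → NonEdgesFar φ → n * n ≤ 2 * (farPairs φ + size G) + n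
  farPairs-lower {φ} far = begin
    n * n                                    ≡⟨ sym ∑∑1 ⟩
    ∑[ w < n ] ∑[ u < n ] 1                ≤⟨ ∑-mono-≤ (λ w → ∑-mono-≤ (1≤pairWeight far w)) ⟩
    ∑[ w < n ] ∑[ u < n ] pairWeight φ w u ≡⟨ ∑∑pairWeight φ ⟩
    2 * (farPairs φ + size G) + n             ∎
    where open ≤-Reasoning

  farPairs-tight : ∀ {φ} → EdgesNear φ → 2 * (farPairs φ + size G) + n ≡ n * n → NonEdgesFar φ
  farPairs-tight {φ} near tight i j i≢j i≁j = far⇒¬Near (separated i≢j i≁j (pairWeight≡1 i j))
    where
    rowSum≡n : ∀ w → ∑[ u < n ] pairWeight φ w u ≡ ∑[ u < n ] 1
    rowSum≡n = ∑-mono-≤-tight (λ w → ∑-mono-≤ (pairWeight≤1 near w))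
      (≤-reflexive (trans ∑∑1 (trans (sym tight) (sym (∑∑pairWeight φ)))))
    pairWeight≡1 : ∀ w u → pairWeight φ w u ≡ 1
    pairWeight≡1 w = ∑-mono-≤-tight (pairWeight≤1 near w) (≤-reflexive (sym (rowSum≡n w)))
    separated : ∀ {i j} → i ≢ j → adj G i j ≡ false → pairWeight φ i j ≡ 1 → φ j < φ i ∸ 1 ⊎ φ i < φ j ∸ 1
    separated {i} {j} i≢j i≁j weight≡1 rewrite i≁j | 𝟙-no (i≢j ∘ sym) (j Fin.≟ i)
      with φ j <? φ i ∸ 1 | φ i <? φ j ∸ 1
    ... | yes j≪i | _       = inj₁ j≪i
    ... | no _    | yes i≪j = inj₂ i≪j
    ... | no _    | no _    = ⊥-elim (0≢1+n weight≡1)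

∸1+𝟙-pos : ∀ x → (x ∸ 1) + 𝟙 (0 <? x) ≡ x
∸1+𝟙-pos zero    = refl
∸1+𝟙-pos (suc x) = +-comm x 1

private
  regroup : ∀ F X m → 2 * (F + X + m) + suc X ≡ 2 * (F + m) + suc X + 2 * X
  regroup = solve-∀

  square : ∀ X → suc X * suc X + 2 * X ≡ (suc X + 2) * X + suc X
  square = solve-∀

-- S, F, X and m stand for the level sum, farPairs, n − 1 and the size.
module _ (S F X m : ℕ) where

  private
    via-F+X : S ≤ F + X → 2 * (S + m) + suc X ≤ 2 * (F + X + m) + suc X
    via-F+X S≤F+X = +-monoˡ-≤ (suc X) (*-monoʳ-≤ 2 (+-monoˡ-≤ m S≤F+X))

    via-pairs : 2 * (F + m) + suc X ≤ suc X * suc X → 2 * (F + X + m) + suc X ≤ (suc X + 2) * X + suc X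
    via-pairs pairs = begin
      2 * (F + X + m) + suc X     ≡⟨ regroup F X m ⟩
      2 * (F + m) + suc X + 2 * X ≤⟨ +-monoˡ-≤ (2 * X) pairs ⟩
      suc X * suc X + 2 * X       ≡⟨ square X ⟩
      (suc X + 2) * X + suc X     ∎
      where open ≤-Reasoning

  bound-arith-≤ : S ≤ F + X → 2 * (F + m) + suc X ≤ suc X * suc X → 2 * (S + m) ≤ (suc X + 2) * X
  bound-arith-≤ S≤F+X pairs = +-cancelʳ-≤ (suc X) _ _ (≤-trans (via-F+X S≤F+X) (via-pairs pairs))

  bound-arith-tight : S ≤ F + X → 2 * (F + m) + suc X ≤ suc X * suc X → 2 * (S + m) ≡ (suc X + 2) * X →
                      S ≡ F + X × 2 * (F + m) + suc X ≡ suc X * suc X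
  bound-arith-tight S≤F+X pairs tight =
      +-cancelʳ-≡ m S (F + X) (*-cancelˡ-≡ _ _ 2 (+-cancelʳ-≡ (suc X) _ _ A≡B))
    , +-cancelʳ-≡ (2 * X) _ _ (trans (sym (regroup F X m)) (trans B≡C (sym (square X))))
    where
    A≤B = via-F+X S≤F+X
    B≤C = via-pairs pairs
    A≡C : 2 * (S + m) + suc X ≡ (suc X + 2) * X + suc X
    A≡C = cong (_+ suc X) tight
    B≡C = ≤-antisym B≤C (≤-trans (≤-reflexive (sym A≡C)) A≤B)
    A≡B = trans A≡C (sym B≡C)

  bound-arith-≥ : F + X ≤ S → suc X * suc X ≤ 2 * (F + m) + suc X → (suc X + 2) * X ≤ 2 * (S + m)
  bound-arith-≥ F+X≤S pairs = +-cancelʳ-≤ (suc X) _ _ (begin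
    (suc X + 2) * X + suc X     ≡⟨ sym (square X) ⟩
    suc X * suc X + 2 * X       ≤⟨ +-monoˡ-≤ (2 * X) pairs ⟩
    2 * (F + m) + suc X + 2 * X ≡⟨ sym (regroup F X m) ⟩
    2 * (F + X + m) + suc X     ≤⟨ +-monoˡ-≤ (suc X) (*-monoʳ-≤ 2 (+-monoˡ-≤ m F+X≤S)) ⟩
    2 * (S + m) + suc X         ∎)
    where open ≤-Reasoning

2*C2+n≡n*n : ∀ N → 2 * (N C 2) + N ≡ N * N
2*C2+n≡n*n zero    = refl
2*C2+n≡n*n (suc N) = begin
  2 * (suc N C 2) + suc N       ≡⟨ cong (λ c → 2 * c + suc N) (sym (nCk+nC[k+1]≡[n+1]C[k+1] N 1)) ⟩
  2 * (N C 1 + N C 2) + suc N   ≡⟨ cong (λ c → 2 * (c + N C 2) + suc N) (nC1≡n N) ⟩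
  2 * (N + N C 2) + suc N       ≡⟨ unfold N (N C 2) ⟩
  (2 * (N C 2) + N) + suc (2 * N) ≡⟨ cong (_+ suc (2 * N)) (2*C2+n≡n*n N) ⟩
  N * N + suc (2 * N)           ≡⟨ square′ N ⟩
  suc N * suc N                 ∎
  where
  open ≡-Reasoning
  unfold : ∀ N c → 2 * (N + c) + suc N ≡ (2 * c + N) + suc (2 * N)
  unfold = solve-∀
  square′ : ∀ N → N * N + suc (2 * N) ≡ suc N * suc N
  square′ = solve-∀

bound-arith-shallow : ∀ S m X → S + 1 ≤ 2 * X → 2 * m + X ≤ X * X → 2 * (S + m) < (suc X + 2) * X
bound-arith-shallow S m X S<2X edges = +-cancelʳ-≤ X _ _ (begin
  suc (2 * (S + m)) + X       ≤⟨ +-monoˡ-≤ X (≤-trans (n≤1+n _) (≤-reflexive (+-comm 2 _))) ⟩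
  2 * (S + m) + 2 + X         ≡⟨ regroup′ S m X ⟩
  2 * (S + 1) + (2 * m + X)   ≤⟨ +-mono-≤ (*-monoʳ-≤ 2 S<2X) edges ⟩
  2 * (2 * X) + X * X         ≡⟨ square″ X ⟩
  (suc X + 2) * X + X         ∎)
  where
  open ≤-Reasoning
  regroup′ : ∀ S m X → 2 * (S + m) + 2 + X ≡ 2 * (S + 1) + (2 * m + X)
  regroup′ = solve-∀
  square″ : ∀ X → 2 * (2 * X) + X * X ≡ (suc X + 2) * X + X
  square″ = solve-∀

module _ {n : ℕ} (φ : Fin n → ℕ) where

  IsRoot : Fin n → Set
  IsRoot v = φ v ≡ 0 × (∀ w → φ w ≡ 0 → w ≡ v)

  suc-#positive : ∀ {v} → IsRoot v → suc (#positive φ) ≡ n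
  suc-#positive {v} (φv≡0 , unique) = begin
    suc (#positive φ)                                  ≡⟨ +-comm 1 _ ⟩
    #positive φ + 1                                    ≡⟨ cong (_+_ (#positive φ)) (sym (∑-δ v)) ⟩
    #positive φ + ∑[ w < n ] 𝟙 (w Fin.≟ v)             ≡⟨ sym (∑-distrib-+ {n} _ _) ⟩
    ∑[ w < n ] (𝟙 (0 <? φ w) + 𝟙 (w Fin.≟ v))         ≡⟨ ∑-cong {n} positive-or-root ⟩
    ∑[ w < n ] 1                                       ≡⟨ trans (∑-const n 1) (*-identityʳ n) ⟩
    n                                                  ∎
    where
    open ≡-Reasoning
    positive-or-root : ∀ w → 𝟙 (0 <? φ w) + 𝟙 (w Fin.≟ v) ≡ 1
    positive-or-root w with w Fin.≟ v
    ... | yes refl rewrite φv≡0 = refl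
    ... | no w≢v   = trans (+-identityʳ _) (𝟙-yes (n≢0⇒n>0 (w≢v ∘ unique w)) (0 <? φ w))

  #below-suc : ∀ K → #below φ (suc K) ≡ #below φ K + #at φ K
  #below-suc K = trans (∑-cong {n} split) (∑-distrib-+ {n} _ _)
    where
    split : ∀ u → 𝟙 (φ u <? suc K) ≡ 𝟙 (φ u <? K) + 𝟙 (φ u ≟ K)
    split u with <-cmp (φ u) K
    ... | tri< lt ne _ = trans (𝟙-yes (m<n⇒m<1+n lt) (φ u <? suc K))
                               (sym (cong₂ _+_ (𝟙-yes lt (φ u <? K)) (𝟙-no ne (φ u ≟ K))))
    ... | tri≈ ≮ eq _  = trans (𝟙-yes (s≤s (≤-reflexive eq)) (φ u <? suc K))
                               (sym (cong₂ _+_ (𝟙-no ≮ (φ u <? K)) (𝟙-yes eq (φ u ≟ K))))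
    ... | tri> ≮ ne gt = trans (𝟙-no (λ lt → <⇒≱ gt (s≤s⁻¹ lt)) (φ u <? suc K))
                               (sym (cong₂ _+_ (𝟙-no ≮ (φ u <? K)) (𝟙-no ne (φ u ≟ K))))

  1≤#at : ∀ {u j} → φ u ≡ j → 1 ≤ #at φ j
  1≤#at {u} {j} φu≡j = ≤-trans (≤-reflexive (sym (𝟙-yes φu≡j (φ u ≟ j)))) (term≤∑ (λ u → 𝟙 (φ u ≟ j)) u)

  #below-+ : ∀ j k → (∀ i → i < k + j → ∃ λ u → φ u ≡ i) → k + #below φ j ≤ #below φ (k + j)
  #below-+ j zero    _        = ≤-refl
  #below-+ j (suc k) occupied = begin
    suc (k + #below φ j)             ≤⟨ s≤s (#below-+ j k (λ i → occupied i ∘ m<n⇒m<1+n)) ⟩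
    suc (#below φ (k + j))           ≡⟨ +-comm 1 _ ⟩
    #below φ (k + j) + 1             ≤⟨ +-monoʳ-≤ (#below φ (k + j)) (1≤#at (proj₂ (occupied (k + j) ≤-refl))) ⟩
    #below φ (k + j) + #at φ (k + j) ≡⟨ sym (#below-suc (k + j)) ⟩
    #below φ (suc k + j)             ∎
    where open ≤-Reasoning

  occupied⇒≤#below : ∀ {K} → (∀ i → i < K → ∃ λ u → φ u ≡ i) → K ≤ #below φ K
  occupied⇒≤#below {K} occupied = begin
    K                  ≤⟨ m≤m+n K _ ⟩
    K + #below φ 0     ≤⟨ #below-+ 0 K (λ i i< → occupied i (<-≤-trans i< (≤-reflexive (+-identityʳ K)))) ⟩
    #below φ (K + 0)   ≡⟨ cong (#below φ) (+-identityʳ K) ⟩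
    #below φ K         ∎
    where open ≤-Reasoning

  private
    levelTerm : Fin n → ℕ
    levelTerm w = #below φ (φ w ∸ 1) + 𝟙 (0 <? φ w)

    ∑levelTerm : sum levelTerm ≡ farPairs φ + #positive φ
    ∑levelTerm = ∑-distrib-+ {n} (λ w → #below φ (φ w ∸ 1)) (λ w → 𝟙 (0 <? φ w))

    ≤levelTerm : ∀ w → φ w ∸ 1 ≤ #below φ (φ w ∸ 1) → φ w ≤ levelTerm w
    ≤levelTerm w crowded = ≤-trans (≤-reflexive (sym (∸1+𝟙-pos (φ w)))) (+-monoˡ-≤ (𝟙 (0 <? φ w)) crowded)

    levelTerm≤ : ∀ w → #below φ (φ w ∸ 1) ≤ φ w ∸ 1 → levelTerm w ≤ φ w
    levelTerm≤ w sparse = ≤-trans (+-monoˡ-≤ (𝟙 (0 <? φ w)) sparse) (≤-reflexive (∸1+𝟙-pos (φ w)))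

  ∑≤farPairs+#positive : (∀ w → φ w ∸ 1 ≤ #below φ (φ w ∸ 1)) → sum φ ≤ farPairs φ + #positive φ
  ∑≤farPairs+#positive crowded = ≤-trans (∑-mono-≤ (λ w → ≤levelTerm w (crowded w))) (≤-reflexive ∑levelTerm)

  farPairs+#positive≤∑ : (∀ w → #below φ (φ w ∸ 1) ≤ φ w ∸ 1) → farPairs φ + #positive φ ≤ sum φ
  farPairs+#positive≤∑ sparse = ≤-trans (≤-reflexive (sym ∑levelTerm)) (∑-mono-≤ (λ w → levelTerm≤ w (sparse w)))

  ∑≡farPairs+#positive⇒#below≡ : (∀ w → φ w ∸ 1 ≤ #below φ (φ w ∸ 1)) → sum φ ≡ farPairs φ + #positive φ →
                                ∀ w → #below φ (φ w ∸ 1) ≡ φ w ∸ 1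
  ∑≡farPairs+#positive⇒#below≡ crowded ∑≡ w =
    +-cancelʳ-≡ (𝟙 (0 <? φ w)) _ _ (trans (sym (φ≡levelTerm w)) (sym (∸1+𝟙-pos (φ w))))
    where
    φ≡levelTerm : ∀ w → φ w ≡ levelTerm w
    φ≡levelTerm = ∑-mono-≤-tight (λ w → ≤levelTerm w (crowded w)) (≤-reflexive (trans ∑levelTerm (sym ∑≡)))

module _ {n : ℕ} (G : Graph n) {φ : Fin n → ℕ} {v : Fin n} (root : IsRoot φ v) where

  private
    X = #positive φ
    1+X≡n : suc X ≡ n
    1+X≡n = suc-#positive φ root

    on-order : (ℕ → ℕ → Set) → ℕ → Set
    on-order R k = R (2 * (sum φ + size G)) ((k + 2) * (k ∸ 1))

    on-pairs : (ℕ → ℕ → Set) → ℕ → Set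
    on-pairs R k = R (2 * (farPairs φ + size G) + k) (k * k)

  levelSum-upper : (∀ w → φ w ∸ 1 ≤ #below φ (φ w ∸ 1)) → EdgesNear G φ →
                   2 * (sum φ + size G) ≤ (n + 2) * (n ∸ 1)
  levelSum-upper crowded near = subst (on-order _≤_) 1+X≡n
    (bound-arith-≤ (sum φ) (farPairs φ) X (size G) (∑≤farPairs+#positive φ crowded)
      (subst (on-pairs _≤_) (sym 1+X≡n) (farPairs-upper G near)))

  levelSum-tight : (∀ w → φ w ∸ 1 ≤ #below φ (φ w ∸ 1)) → EdgesNear G φ →
                   2 * (sum φ + size G) ≡ (n + 2) * (n ∸ 1) →
                   NonEdgesFar G φ × (∀ w → #below φ (φ w ∸ 1) ≡ φ w ∸ 1)
  levelSum-tight crowded near tight =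
      farPairs-tight G near (subst (on-pairs _≡_) 1+X≡n pairs≡)
    , ∑≡farPairs+#positive⇒#below≡ φ crowded ∑≡
    where
    arith = bound-arith-tight (sum φ) (farPairs φ) X (size G) (∑≤farPairs+#positive φ crowded)
               (subst (on-pairs _≤_) (sym 1+X≡n) (farPairs-upper G near)) (subst (on-order _≡_) (sym 1+X≡n) tight)
    ∑≡ = proj₁ arith
    pairs≡ = proj₂ arith

  levelSum-lower : (∀ w → #below φ (φ w ∸ 1) ≤ φ w ∸ 1) → NonEdgesFar G φ →
                   (n + 2) * (n ∸ 1) ≤ 2 * (sum φ + size G)
  levelSum-lower sparse far = subst (on-order (λ a b → b ≤ a)) 1+X≡n
    (bound-arith-≥ (sum φ) (farPairs φ) X (size G) (farPairs+#positive≤∑ φ sparse)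
      (subst (on-pairs (λ a b → b ≤ a)) (sym 1+X≡n) (farPairs-lower G far)))

  levelSum-shallow : (∀ w → φ w ≤ 2) → (∃ λ u → φ u ≡ 1) → size G ≤ (n ∸ 1) C 2 →
                     2 * (sum φ + size G) < (n + 2) * (n ∸ 1)
  levelSum-shallow shallow (u , φu≡1) m≤C = subst (on-order _<_) 1+X≡n
    (bound-arith-shallow (sum φ) (size G) X S<2X
      (≤-trans (+-monoˡ-≤ X (*-monoʳ-≤ 2 (subst (λ k → size G ≤ (k ∸ 1) C 2) (sym 1+X≡n) m≤C)))
               (≤-reflexive (2*C2+n≡n*n X))))
    where
    x+𝟙≤2*𝟙 : ∀ x → x ≤ 2 → x + 𝟙 (x ≟ 1) ≤ 2 * 𝟙 (0 <? x)
    x+𝟙≤2*𝟙 0 _ = z≤n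
    x+𝟙≤2*𝟙 1 _ = ≤-refl
    x+𝟙≤2*𝟙 2 _ = ≤-refl
    x+𝟙≤2*𝟙 (suc (suc (suc _))) (s≤s (s≤s ()))
    S<2X : sum φ + 1 ≤ 2 * X
    S<2X = begin
      sum φ + 1                              ≤⟨ +-monoʳ-≤ (sum φ) (1≤#at φ φu≡1) ⟩
      sum φ + #at φ 1                        ≡⟨ sym (∑-distrib-+ {n} φ _) ⟩
      ∑[ w < n ] (φ w + 𝟙 (φ w ≟ 1))         ≤⟨ ∑-mono-≤ (λ w → x+𝟙≤2*𝟙 (φ w) (shallow w)) ⟩
      ∑[ w < n ] (2 * 𝟙 (0 <? φ w))          ≡⟨ sym (*-distribˡ-sum {n} 2 _) ⟩
      2 * X                                  ∎
      where open ≤-Reasoning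

-- Reachability and distances

module _ {n : ℕ} (G : Graph n) where

  reach-suc : ∀ {k u w} → reachWithin G k u w ≡ true → reachWithin G (suc k) u w ≡ true
  reach-suc {k} {u} {w} u⇝w = cong (_∨ any (λ x → reachWithin G k u x ∧ adj G x w) (allFin n)) u⇝w

  reach-self : ∀ k u → reachWithin G k u u ≡ true
  reach-self zero    u = Equivalence.to T-≡ (fromWitness {a? = u Fin.≟ u} refl)
  reach-self (suc k) u = reach-suc {k} (reach-self k u)

  reach-zero : ∀ {u w} → reachWithin G 0 u w ≡ true → u ≡ w
  reach-zero {u} {w} u⇝w = toWitness {a? = u Fin.≟ w} (Equivalence.from T-≡ u⇝w)

  reach-step : ∀ {k u x w} → reachWithin G k u x ≡ true → adj G x w ≡ true → reachWithin G (suc k) u w ≡ true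
  reach-step {k} {u} {x} {w} u⇝x x~w =
    trans (cong (reachWithin G k u w ∨_) (any-allFin⁺ _ x (cong₂ _∧_ u⇝x x~w))) (∨-zeroʳ _)

  reach-back : ∀ {k u w} → reachWithin G (suc k) u w ≡ true →
               reachWithin G k u w ≡ true ⊎ ∃ λ x → reachWithin G k u x ≡ true × adj G x w ≡ true
  reach-back {k} {u} {w} u⇝w with reachWithin G k u w
  ... | true  = inj₁ refl
  ... | false with x , u⇝x∧x~w ← any-allFin⁻ _ u⇝w = inj₂ (x , ∧-≡-true u⇝x∧x~w)

-- Defs keeps the search behind dist private. The equation below names it (abstracting 1 and suc m
-- makes it a pattern), after which dist G u w is firstReach G u w 0 n by definition.
mutual
  firstReach : ∀ {n} → Graph n → Fin n → Fin n → ℕ → ℕ → ℕ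
  firstReach = _

  dist-unfold : ∀ {m} (G : Graph (suc m)) u w →
                dist G u w ≡ (if reachWithin G 0 u w then 0 else firstReach G u w 1 m)
  dist-unfold {m} G u w with suc m | 1
  ... | _ | _ = refl

dist-self : ∀ {n} (G : Graph n) u → dist G u u ≡ 0
dist-self {suc m} G u rewrite dist-unfold G u u | reach-self G 0 u = refl

module _ {n : ℕ} (G : Graph n) (u w : Fin n) where

  firstReach-found : ∀ k f → firstReach G u w k f < k + f → reachWithin G (firstReach G u w k f) u w ≡ true
  firstReach-found k zero    lt = ⊥-elim (<-irrefl (sym (+-identityʳ k)) lt)
  firstReach-found k (suc f) lt with reachWithin G k u w in u⇝w
  ... | true  = u⇝w
  ... | false = firstReach-found (suc k) f (<-≤-trans lt (≤-reflexive (+-suc k f)))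

  firstReach-minimal : ∀ k f j → k ≤ j → j < firstReach G u w k f → reachWithin G j u w ≡ false
  firstReach-minimal k zero    j k≤j j<k = ⊥-elim (<⇒≱ j<k k≤j)
  firstReach-minimal k (suc f) j k≤j j< with reachWithin G k u w in u⇝w
  ... | true  = ⊥-elim (<⇒≱ j< k≤j)
  ... | false with m≤n⇒m<n∨m≡n k≤j
  ...   | inj₁ k<j  = firstReach-minimal (suc k) f j k<j j<
  ...   | inj₂ refl = u⇝w

  dist-minimal : ∀ {j} → j < dist G u w → reachWithin G j u w ≡ false
  dist-minimal {j} = firstReach-minimal 0 n j z≤n

  dist-least : ∀ {k} → reachWithin G k u w ≡ true → dist G u w ≤ k
  dist-least {k} u⇝w with dist G u w ≤? k
  ... | yes ≤k = ≤k
  ... | no  ≰k = ⊥-elim (true≢false (trans (sym u⇝w) (dist-minimal (≰⇒> ≰k))))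

module _ {n : ℕ} (G : Graph n) where

  walk-crossing : ∀ (B : Fin n → Bool) {x y k} → Walk G x y k → B x ≡ true → B y ≡ false →
                  ∃ λ a → ∃ λ b → B a ≡ true × adj G a b ≡ true × B b ≡ false
  walk-crossing B (here _)                 Bx By = ⊥-elim (true≢false (trans (sym Bx) By))
  walk-crossing B (step {v = z} x~z z⇝y) Bx By with B z in Bz
  ... | true  = walk-crossing B z⇝y Bz By
  ... | false = _ , z , Bx , x~z , Bz

  #reached : ℕ → Fin n → ℕ
  #reached k u = ∑[ x < n ] 𝟙ᵇ (reachWithin G k u x)

  #reached<n : ∀ {k u w} → reachWithin G k u w ≡ false → #reached k u < n
  #reached<n {k} {u} {w} ¬u⇝w = begin-strict
    #reached k u             <⟨ ∑-mono-< (λ x → 𝟙ᵇ≤1 (reachWithin G k u x)) w (≤-reflexive (cong (suc ∘ 𝟙ᵇ) ¬u⇝w)) ⟩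
    ∑[ x < n ] 1             ≡⟨ trans (∑-const n 1) (*-identityʳ n) ⟩
    n                        ∎
    where open ≤-Reasoning

  -- While w is unreached, a walk from u to w leaves the reached set, so every step reaches a new vertex.
  unreached⇒k<#reached : Connected G → ∀ {k u w} → reachWithin G k u w ≡ false → k < #reached k u
  unreached⇒k<#reached conn {zero}  {u} _ = ≤-trans (≤-reflexive (cong 𝟙ᵇ (sym (reach-self G 0 u))))
                                                     (term≤∑ (λ x → 𝟙ᵇ (reachWithin G 0 u x)) u)
  unreached⇒k<#reached conn {suc k} {u} {w} ¬u⇝w = <-≤-trans (s≤s (unreached⇒k<#reached conn ¬u⇝ₖw)) grows
    where
    ¬u⇝ₖw : reachWithin G k u w ≡ false
    ¬u⇝ₖw = ¬-≡-true⇒≡false (λ u⇝w → true≢false (trans (sym (reach-suc G {k} u⇝w)) ¬u⇝w))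
    crossing = walk-crossing (reachWithin G k u) (proj₂ (conn u w)) (reach-self G k u) ¬u⇝ₖw
    grows : suc (#reached k u) ≤ #reached (suc k) u
    grows with a , b , u⇝a , a~b , ¬u⇝b ← crossing =
      ∑-mono-< (λ x → 𝟙ᵇ-mono (reach-suc G {k} {u} {x})) b
        (subst₂ (λ p q → 𝟙ᵇ p < 𝟙ᵇ q) (sym ¬u⇝b) (sym (reach-step G {k} {u} u⇝a a~b)) ≤-refl)

  level≤reach : ∀ {φ} → EdgesNear G φ → ∀ {u} → φ u ≡ 0 → ∀ k w → reachWithin G k u w ≡ true → φ w ≤ k
  level≤reach {φ} near φu≡0 zero w u⇝w = ≤-reflexive (trans (cong φ (sym (reach-zero G u⇝w))) φu≡0)
  level≤reach {φ} near φu≡0 (suc k) w u⇝w with reach-back G {k} u⇝w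
  ... | inj₁ u⇝ₖw             = m≤n⇒m≤1+n (level≤reach near φu≡0 k w u⇝ₖw)
  ... | inj₂ (x , u⇝x , x~w) = ≤-trans (proj₂ (near x w x~w)) (s≤s (level≤reach near φu≡0 k x u⇝x))

  module _ (conn : Connected G) where

    dist<n : ∀ u w → dist G u w < n
    dist<n u w with dist G u w <? n
    ... | yes d<n = d<n
    ... | no  d≮n = ⊥-elim (<-irrefl refl (≤-<-trans n≤#reached (#reached<n {pred n} {u} {w} ¬u⇝w)))
      where
      instance _ = Fin.nonZeroIndex u
      ¬u⇝w : reachWithin G (pred n) u w ≡ false
      ¬u⇝w = dist-minimal G u w (≤-trans (≤-reflexive (suc-pred n)) (≮⇒≥ d≮n))
      n≤#reached : n ≤ #reached (pred n) u
      n≤#reached = ≤-trans (≤-reflexive (sym (suc-pred n))) (unreached⇒k<#reached conn ¬u⇝w)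

    dist-reach : ∀ u w → reachWithin G (dist G u w) u w ≡ true
    dist-reach u w = firstReach-found G u w 0 n (dist<n u w)

    dist-zero : ∀ {u w} → dist G u w ≡ 0 → u ≡ w
    dist-zero {u} {w} d≡0 = reach-zero G (subst (λ k → reachWithin G k u w ≡ true) d≡0 (dist-reach u w))

    dist-edge : ∀ u {x w} → adj G x w ≡ true → dist G u w ≤ suc (dist G u x)
    dist-edge u {x} x~w = dist-least G u _ (reach-step G {dist G u x} (dist-reach u x) x~w)

    dist-pred : ∀ {u w j} → dist G u w ≡ suc j → ∃ λ x → dist G u x ≡ j
    dist-pred {u} {w} {j} d≡1+j with reach-back G {j} (subst (λ k → reachWithin G k u w ≡ true) d≡1+j (dist-reach u w))
    ... | inj₁ u⇝w = ⊥-elim (true≢false (trans (sym u⇝w) (dist-minimal G u w (≤-reflexive (sym d≡1+j)))))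
    ... | inj₂ (x , u⇝x , x~w) = x , ≤-antisym (dist-least G u x u⇝x) j≤dx
      where
      j≤dx : j ≤ dist G u x
      j≤dx = s≤s⁻¹ (≤-trans (≤-reflexive (sym d≡1+j)) (dist-edge u x~w))

    dist-levels : ∀ u w {j} → j ≤ dist G u w → ∃ λ x → dist G u x ≡ j
    dist-levels u w {j} j≤d = descend (dist G u w ∸ j) w (sym (m+[n∸m]≡n j≤d))
      where
      descend : ∀ t x → dist G u x ≡ j + t → ∃ λ y → dist G u y ≡ j
      descend zero    x dx≡j   = x , trans dx≡j (+-identityʳ j)
      descend (suc t) x dx≡j+t with y , dy≡j+t ← dist-pred (trans dx≡j+t (+-suc j t)) = descend t y dy≡j+t

    dist-isRoot : ∀ u → IsRoot (dist G u) u
    dist-isRoot u = dist-self G u , λ w d≡0 → sym (dist-zero d≡0)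

    dist-edgesNear : ∀ u → EdgesNear G (dist G u)
    dist-edgesNear u i j i~j = dist-edge u (trans (adj-sym G j i) i~j) , dist-edge u i~j

    dist∸1≤#below : ∀ u w → dist G u w ∸ 1 ≤ #below (dist G u) (dist G u w ∸ 1)
    dist∸1≤#below u w = occupied⇒≤#below (dist G u) λ i i< →
      dist-levels u w (≤-trans (<⇒≤ i<) (m∸n≤m (dist G u w) 1))

    level≤dist : ∀ {φ} → EdgesNear G φ → ∀ {u} → φ u ≡ 0 → ∀ w → φ w ≤ dist G u w
    level≤dist near {u} φu≡0 w = level≤reach near φu≡0 (dist G u w) w (dist-reach u w)

-- Layerings and path-complete graphs

module _ {n : ℕ} where

  IsLayering : Graph n → (Fin n → ℕ) → Set
  IsLayering G φ = ∀ i j → adj G i j ≡ true ⇔ (i ≢ j × Near (φ i) (φ j))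

  module _ {G : Graph n} {φ : Fin n → ℕ} where

    layering-edgesNear : IsLayering G φ → EdgesNear G φ
    layering-edgesNear layer i j i~j = proj₂ (Equivalence.to (layer i j) i~j)

    layering-nonEdgesFar : IsLayering G φ → NonEdgesFar G φ
    layering-nonEdgesFar layer i j i≢j i≁j near =
      true≢false (trans (sym (Equivalence.from (layer i j) (i≢j , near))) i≁j)

    layering : EdgesNear G φ → NonEdgesFar G φ → IsLayering G φ
    layering near far i j = mk⇔
      (λ i~j → (λ { refl → true≢false (trans (sym i~j) (adj-irrefl G i)) }) , near i j i~j)
      (λ (i≢j , nr) → ¬-≡-false⇒≡true (λ i≁j → far i j i≢j i≁j nr))

  module _ (f g : Fin n → Fin n) (gf : ∀ i → g (f i) ≡ i) where

    private
      f-injective : ∀ {i j} → f i ≡ f j → i ≡ j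
      f-injective {i} {j} fi≡fj = trans (sym (gf i)) (trans (cong g fi≡fj) (gf j))

    layering-≅ : ∀ {G H φ ψ} → IsLayering G φ → IsLayering H ψ → (∀ j → f (g j) ≡ j) →
                 (∀ i → ψ (f i) ≡ φ i) → G ≅ H
    layering-≅ {G} {H} {φ} {ψ} layerG layerH fg ψf≡φ =
      f , g , gf , fg , λ i j → ⇔→≡ (mk⇔ (to i j) (from i j))
      where
      to : ∀ i j → adj H (f i) (f j) ≡ true → adj G i j ≡ true
      to i j fi~fj with fi≢fj , near ← Equivalence.to (layerH (f i) (f j)) fi~fj =
        Equivalence.from (layerG i j) (fi≢fj ∘ cong f , subst₂ Near (ψf≡φ i) (ψf≡φ j) near)
      from : ∀ i j → adj G i j ≡ true → adj H (f i) (f j) ≡ true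
      from i j i~j with i≢j , near ← Equivalence.to (layerG i j) i~j =
        Equivalence.from (layerH (f i) (f j)) (i≢j ∘ f-injective , subst₂ Near (sym (ψf≡φ i)) (sym (ψf≡φ j)) near)

    ≅-layering : ∀ {G H ψ} → (∀ i j → adj H (f i) (f j) ≡ adj G i j) → IsLayering H ψ → IsLayering G (ψ ∘ f)
    ≅-layering {G} {H} adj-f layerH i j = mk⇔
      (λ i~j → let (fi≢fj , near) = Equivalence.to (layerH (f i) (f j)) (trans (adj-f i j) i~j)
               in fi≢fj ∘ cong f , near)
      (λ (i≢j , near) → trans (sym (adj-f i j)) (Equivalence.from (layerH (f i) (f j)) (i≢j ∘ f-injective , near)))

-- Defs keeps the block index of pathComplete private; pcLevel copies it, as pathComplete-adj confirms.
pcLevel : ℕ → ℕ → ℕ → ℕ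
pcLevel ℓ a i = if i ≤ᵇ ℓ then i else (if i ≤ᵇ ℓ + a then suc ℓ else suc (suc ℓ))

pathComplete-adj : ∀ n ℓ a b (i j : Fin n) → let p = pcLevel ℓ a (toℕ i); q = pcLevel ℓ a (toℕ j) in
                   adj (pathComplete n ℓ a b) i j ≡ not ⌊ i Fin.≟ j ⌋ ∧ ((p ≤ᵇ suc q) ∧ (q ≤ᵇ suc p))
pathComplete-adj n ℓ a b i j = refl

pathComplete-layering : ∀ n ℓ a b → IsLayering (pathComplete n ℓ a b) (pcLevel ℓ a ∘ toℕ)
pathComplete-layering n ℓ a b i j = mk⇔ to from
  where
  p = pcLevel ℓ a (toℕ i)
  q = pcLevel ℓ a (toℕ j)
  to : adj (pathComplete n ℓ a b) i j ≡ true → i ≢ j × Near p q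
  to i~j
    with i≢j , near ← Equivalence.to (T-∧ {not ⌊ i Fin.≟ j ⌋})
                        (Equivalence.from T-≡ (trans (sym (pathComplete-adj n ℓ a b i j)) i~j))
    with p≤1+q , q≤1+p ← Equivalence.to (T-∧ {p ≤ᵇ suc q}) near
    = toWitnessFalse i≢j , ≤ᵇ⇒≤ p (suc q) p≤1+q , ≤ᵇ⇒≤ q (suc p) q≤1+p
  from : i ≢ j × Near p q → adj (pathComplete n ℓ a b) i j ≡ true
  from (i≢j , p≤1+q , q≤1+p) = trans (pathComplete-adj n ℓ a b i j) (Equivalence.to T-≡
    (Equivalence.from (T-∧ {not ⌊ i Fin.≟ j ⌋})
      (fromWitnessFalse i≢j , Equivalence.from T-∧ (≤⇒≤ᵇ p≤1+q , ≤⇒≤ᵇ q≤1+p))))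

module _ (ℓ a : ℕ) where

  private
    ≤ᵇ-true : ∀ {x y} → x ≤ y → (x ≤ᵇ y) ≡ true
    ≤ᵇ-true = Equivalence.to T-≡ ∘ ≤⇒≤ᵇ

    ≤ᵇ-false : ∀ {x y} → ¬ x ≤ y → (x ≤ᵇ y) ≡ false
    ≤ᵇ-false {x} {y} x≰y = ¬-≡-true⇒≡false (x≰y ∘ ≤ᵇ⇒≤ x y ∘ Equivalence.from T-≡)

  pcLevel-low : ∀ {i} → i ≤ ℓ → pcLevel ℓ a i ≡ i
  pcLevel-low i≤ℓ rewrite ≤ᵇ-true i≤ℓ = refl

  pcLevel-mid : ∀ {i} → ℓ < i → i ≤ ℓ + a → pcLevel ℓ a i ≡ suc ℓ
  pcLevel-mid ℓ<i i≤ℓ+a rewrite ≤ᵇ-false (<⇒≱ ℓ<i) | ≤ᵇ-true i≤ℓ+a = refl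

  pcLevel-high : ∀ {i} → ℓ + a < i → pcLevel ℓ a i ≡ suc (suc ℓ)
  pcLevel-high ℓ+a<i rewrite ≤ᵇ-false (<⇒≱ (≤-<-trans (m≤m+n ℓ a) ℓ+a<i)) | ≤ᵇ-false (<⇒≱ ℓ+a<i) = refl

  pcLevel-≤ℓ : ∀ i → pcLevel ℓ a i ≤ ℓ → pcLevel ℓ a i ≡ i
  pcLevel-≤ℓ i lvl≤ℓ with i ≤? ℓ | i ≤? ℓ + a
  ... | yes i≤ℓ | _        = pcLevel-low i≤ℓ
  ... | no  i≰ℓ | yes i≤ℓ+a =
    ⊥-elim (<⇒≱ (subst (ℓ <_) (sym (pcLevel-mid (≰⇒> i≰ℓ) i≤ℓ+a)) ≤-refl) lvl≤ℓ)
  ... | no  _   | no i≰ℓ+a  =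
    ⊥-elim (<⇒≱ (subst (ℓ <_) (sym (pcLevel-high (≰⇒> i≰ℓ+a))) (n≤1+n (suc ℓ))) lvl≤ℓ)

  pcLevel≤2+ℓ : ∀ i → pcLevel ℓ a i ≤ suc (suc ℓ)
  pcLevel≤2+ℓ i with i ≤? ℓ | i ≤? ℓ + a
  ... | yes i≤ℓ | _        = ≤-trans (≤-reflexive (pcLevel-low i≤ℓ)) (m≤n⇒m≤1+n (m≤n⇒m≤1+n i≤ℓ))
  ... | no  i≰ℓ | yes i≤ℓ+a = ≤-trans (≤-reflexive (pcLevel-mid (≰⇒> i≰ℓ) i≤ℓ+a)) (n≤1+n (suc ℓ))
  ... | no  _   | no i≰ℓ+a  = ≤-reflexive (pcLevel-high (≰⇒> i≰ℓ+a))

#below-toℕ : ∀ {n} K → #below (toℕ {n}) K ≤ K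
#below-toℕ {zero}  K       = z≤n
#below-toℕ {suc n} zero    =
  ≤-reflexive (trans (∑-cong {n} λ i → 𝟙-no (λ ()) (suc (toℕ i) <? 0)) (trans (∑-const n 0) (*-zeroʳ n)))
#below-toℕ {suc n} (suc K) = s≤s (≤-trans
  (≤-reflexive (∑-cong {n} λ i → 𝟙-cong s≤s⁻¹ s≤s (suc (toℕ i) <? suc K) (toℕ i <? K))) (#below-toℕ {n} K))

injective⇒surjective : ∀ {k} (f : Fin k → Fin k) → (∀ {x y} → f x ≡ f y → x ≡ y) → ∀ j → ∃ λ i → f i ≡ j
injective⇒surjective {suc k} f f-inj j with Fin.any? (λ i → f i Fin.≟ j)
... | yes hit = hit
... | no  miss = ⊥-elim (<-irrefl refl (Fin.injective⇒≤ f′-injective))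
  where
  f′ : Fin (suc k) → Fin k
  f′ i = Fin.punchOut {i = j} {j = f i} (λ j≡fi → miss (i , sym j≡fi))
  f′-injective : ∀ {x y} → f′ x ≡ f′ y → x ≡ y
  f′-injective {x} {y} = f-inj ∘ Fin.punchOut-injective {i = j} _ _

module _ {n : ℕ} (φ : Fin n → ℕ) where

  #below-mono : ∀ {K K′} → K ≤ K′ → #below φ K ≤ #below φ K′
  #below-mono K≤K′ = ∑-mono-≤ λ u → 𝟙-mono (λ φu<K → <-≤-trans φu<K K≤K′) (φ u <? _) (φ u <? _)

  #below≤n : ∀ K → #below φ K ≤ n
  #below≤n K = ≤-trans (∑-mono-≤ λ u → 𝟙≤1 (φ u <? K)) (≤-reflexive (trans (∑-const n 1) (*-identityʳ n)))

  #below-all : ∀ {K} → (∀ u → φ u < K) → #below φ K ≡ n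
  #below-all {K} all< = trans (∑-cong {n} λ u → 𝟙-yes (all< u) (φ u <? K)) (trans (∑-const n 1) (*-identityʳ n))

  #below-exact : ∀ {K} → (∀ i → i < K → ∃ λ u → φ u ≡ i) → #below φ K ≡ K → ∀ {j} → j ≤ K → #below φ j ≡ j
  #below-exact {K} occupied #below≡K {j} j≤K =
    ≤-antisym (+-cancelˡ-≤ (K ∸ j) _ _ gap) (occupied⇒≤#below φ (λ i i<j → occupied i (<-≤-trans i<j j≤K)))
    where
    K∸j+j≡K = m∸n+n≡m j≤K
    gap : (K ∸ j) + #below φ j ≤ (K ∸ j) + j
    gap = begin
      (K ∸ j) + #below φ j  ≤⟨ #below-+ φ j (K ∸ j) (λ i i< → occupied i (<-≤-trans i< (≤-reflexive K∸j+j≡K))) ⟩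
      #below φ (K ∸ j + j)  ≡⟨ cong (#below φ) K∸j+j≡K ⟩
      #below φ K            ≡⟨ trans #below≡K (sym K∸j+j≡K) ⟩
      (K ∸ j) + j           ∎
      where open ≤-Reasoning

  #tiesBefore : Fin n → ℕ
  #tiesBefore w = ∑[ u < n ] 𝟙 ((φ u ≟ φ w) ×-dec (toℕ u <? toℕ w))

  -- The position of w when the vertices are sorted by level, ties broken by index.
  rank : Fin n → ℕ
  rank w = #below φ (φ w) + #tiesBefore w

  #tiesBefore-< : ∀ {w w′} → φ w ≡ φ w′ → toℕ w < toℕ w′ → #tiesBefore w < #tiesBefore w′
  #tiesBefore-< {w} {w′} φw≡φw′ w<w′ = ∑-mono-<
    (λ u → 𝟙-mono (λ (φu≡φw , u<w) → trans φu≡φw φw≡φw′ , <-trans u<w w<w′)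
                   ((φ u ≟ φ w) ×-dec (toℕ u <? toℕ w)) ((φ u ≟ φ w′) ×-dec (toℕ u <? toℕ w′))) w
    (subst₂ _<_ (sym (𝟙-no (λ (_ , w<w) → <-irrefl refl w<w) ((φ w ≟ φ w) ×-dec (toℕ w <? toℕ w))))
                (sym (𝟙-yes (φw≡φw′ , w<w′) ((φ w ≟ φ w′) ×-dec (toℕ w <? toℕ w′)))) ≤-refl)

  rank<#below-suc : ∀ w → rank w < #below φ (suc (φ w))
  rank<#below-suc w = <-≤-trans (+-monoʳ-< (#below φ (φ w)) ties<#at) (≤-reflexive (sym (#below-suc φ (φ w))))
    where
    ties<#at : #tiesBefore w < #at φ (φ w)
    ties<#at = ∑-mono-< (λ u → 𝟙-mono proj₁ ((φ u ≟ φ w) ×-dec (toℕ u <? toℕ w)) (φ u ≟ φ w)) w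
      (subst₂ _<_ (sym (𝟙-no (λ (_ , w<w) → <-irrefl refl w<w) ((φ w ≟ φ w) ×-dec (toℕ w <? toℕ w))))
                  (sym (𝟙-yes refl (φ w ≟ φ w))) ≤-refl)

  rank<n : ∀ w → rank w < n
  rank<n w = <-≤-trans (rank<#below-suc w) (#below≤n (suc (φ w)))

  rank-<-level : ∀ {x y} → φ x < φ y → rank x < rank y
  rank-<-level {x} {y} φx<φy = <-≤-trans (rank<#below-suc x) (≤-trans (#below-mono φx<φy) (m≤m+n _ _))

  rank≡⇒ties≡ : ∀ {w w′} → rank w ≡ rank w′ → φ w ≡ φ w′ → #tiesBefore w ≡ #tiesBefore w′
  rank≡⇒ties≡ {w} {w′} r≡r′ φw≡φw′ =
    +-cancelˡ-≡ (#below φ (φ w)) _ _ (trans r≡r′ (cong (λ k → #below φ k + #tiesBefore w′) (sym φw≡φw′)))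

  rank-injective : ∀ {w w′} → rank w ≡ rank w′ → w ≡ w′
  rank-injective {w} {w′} r≡r′ with <-cmp (φ w) (φ w′)
  ... | tri< φw<φw′ _ _ = ⊥-elim (<-irrefl r≡r′ (rank-<-level φw<φw′))
  ... | tri> _ _ φw′<φw = ⊥-elim (<-irrefl (sym r≡r′) (rank-<-level φw′<φw))
  ... | tri≈ _ φw≡φw′ _ with <-cmp (toℕ w) (toℕ w′)
  ...   | tri< w<w′ _ _ = ⊥-elim (<-irrefl (rank≡⇒ties≡ r≡r′ φw≡φw′) (#tiesBefore-< φw≡φw′ w<w′))
  ...   | tri≈ _ w≡w′ _ = Fin.toℕ-injective w≡w′
  ...   | tri> _ _ w′<w = ⊥-elim (<-irrefl (sym (rank≡⇒ties≡ r≡r′ φw≡φw′)) (#tiesBefore-< (sym φw≡φw′) w′<w))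

module _ {n : ℕ} {G : Graph n} {φ : Fin n → ℕ} (ℓ : ℕ) (layer : IsLayering G φ)
         (top : ∀ w → φ w ≤ suc (suc ℓ)) (path : ∀ {j} → j ≤ suc ℓ → #below φ j ≡ j) where

  private
    a = #at φ (suc ℓ)
    b = #at φ (suc (suc ℓ))

    #below-2+ℓ : #below φ (suc (suc ℓ)) ≡ suc ℓ + a
    #below-2+ℓ = trans (#below-suc φ (suc ℓ)) (cong (_+ a) (path ≤-refl))

    pcLevel-rank : ∀ w → pcLevel ℓ a (rank φ w) ≡ φ w
    pcLevel-rank w with <-cmp (φ w) (suc ℓ)
    ... | tri< φw≤ℓ _ _ = trans (pcLevel-low ℓ a (≤-trans (≤-reflexive rank≡φw) (s≤s⁻¹ φw≤ℓ))) rank≡φw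
      where
      rank≡φw : rank φ w ≡ φ w
      rank≡φw = ≤-antisym (s≤s⁻¹ (<-≤-trans (rank<#below-suc φ w) (≤-reflexive (path φw≤ℓ))))
                          (≤-trans (≤-reflexive (sym (path (<⇒≤ φw≤ℓ)))) (m≤m+n _ _))
    ... | tri≈ _ φw≡1+ℓ _ = trans (pcLevel-mid ℓ a ℓ<rank rank≤ℓ+a) (sym φw≡1+ℓ)
      where
      ℓ<rank : ℓ < rank φ w
      ℓ<rank = ≤-trans (≤-reflexive (sym (trans (cong (#below φ) φw≡1+ℓ) (path ≤-refl)))) (m≤m+n _ _)
      rank≤ℓ+a : rank φ w ≤ ℓ + a
      rank≤ℓ+a = s≤s⁻¹ (<-≤-trans (rank<#below-suc φ w) (≤-reflexive (trans (cong (#below φ ∘ suc) φw≡1+ℓ) #below-2+ℓ)))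
    ... | tri> _ _ 1+ℓ<φw = trans (pcLevel-high ℓ a ℓ+a<rank) (sym φw≡2+ℓ)
      where
      φw≡2+ℓ : φ w ≡ suc (suc ℓ)
      φw≡2+ℓ = ≤-antisym (top w) 1+ℓ<φw
      ℓ+a<rank : ℓ + a < rank φ w
      ℓ+a<rank = ≤-trans (≤-reflexive (sym (trans (cong (#below φ) φw≡2+ℓ) #below-2+ℓ))) (m≤m+n _ _)

    f : Fin n → Fin n
    f w = Fin.fromℕ< (rank<n φ w)

    f-injective : ∀ {x y} → f x ≡ f y → x ≡ y
    f-injective {x} {y} fx≡fy =
      rank-injective φ (trans (sym (Fin.toℕ-fromℕ< (rank<n φ x))) (trans (cong toℕ fx≡fy) (Fin.toℕ-fromℕ< (rank<n φ y))))

    g : Fin n → Fin n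
    g j = proj₁ (injective⇒surjective f f-injective j)

    fg : ∀ j → f (g j) ≡ j
    fg j = proj₂ (injective⇒surjective f f-injective j)

  layering⇒order : n ≡ 1 + ℓ + a + b
  layering⇒order = begin
    n                                            ≡⟨ sym (#below-all φ {suc (suc (suc ℓ))} (s≤s ∘ top)) ⟩
    #below φ (suc (suc (suc ℓ)))                 ≡⟨ #below-suc φ (suc (suc ℓ)) ⟩
    #below φ (suc (suc ℓ)) + b                   ≡⟨ cong (_+ b) #below-2+ℓ ⟩
    1 + ℓ + a + b                                ∎
    where open ≡-Reasoning

  layering⇒≅pathComplete : G ≅ pathComplete n ℓ a b
  layering⇒≅pathComplete =
    layering-≅ f g (λ i → f-injective (fg (f i))) {G} {pathComplete n ℓ a b} {φ}
      layer (pathComplete-layering n ℓ a b) fg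
      (λ w → trans (cong (pcLevel ℓ a) (Fin.toℕ-fromℕ< (rank<n φ w))) (pcLevel-rank w))

layering⇒pathComplete : ∀ {n} {G : Graph n} {φ : Fin n → ℕ} → IsLayering G φ → ∀ e →
  (∀ w → φ w ≤ e) → (∀ {j} → j ≤ e → ∃ λ u → φ u ≡ j) → #below φ (e ∸ 1) ≡ e ∸ 1 → 3 ≤ e →
  ∃ λ ℓ → ∃ λ a → ∃ λ b → IsPCParams n ℓ a b × G ≅ pathComplete n ℓ a b
layering⇒pathComplete {G = G} {φ} layer (suc (suc ℓ)) top occupied #below≡ (s≤s (s≤s 1≤ℓ)) =
    ℓ , #at φ (suc ℓ) , #at φ (suc (suc ℓ))
  , ( 1≤ℓ , 1≤#at φ (proj₂ (occupied (n≤1+n _))) , 1≤#at φ (proj₂ (occupied ≤-refl))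
    , layering⇒order {G = G} ℓ layer top path)
  , layering⇒≅pathComplete {G = G} ℓ layer top path
  where
  path : ∀ {j} → j ≤ suc ℓ → #below φ j ≡ j
  path = #below-exact φ (λ i i<1+ℓ → occupied (≤-trans (<⇒≤ i<1+ℓ) (n≤1+n _))) #below≡

-- The transmission bound and its extremal graphs

transmission≡∑dist : ∀ {n} (G : Graph n) v → transmission G v ≡ sum (dist G v)
transmission≡∑dist G v = sum-tabulate (λ w → w) (dist G v)

transmission-upper : ∀ {n} (G : Graph n) → Connected G → ∀ v → 2 * (transmission G v + size G) ≤ (n + 2) * (n ∸ 1)
transmission-upper G conn v rewrite transmission≡∑dist G v =
  levelSum-upper G (dist-isRoot G conn v) (dist∸1≤#below G conn v) (dist-edgesNear G conn v)

other-vertex : ∀ {n} → 2 ≤ n → (v : Fin n) → ∃ λ w → w ≢ v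
other-vertex (s≤s (s≤s z≤n)) Fin.zero    = Fin.suc Fin.zero , λ ()
other-vertex (s≤s (s≤s z≤n)) (Fin.suc _) = Fin.zero , λ ()

transmission-tight⇒pathComplete : ∀ {n} (G : Graph n) → Connected G → 2 ≤ n → size G ≤ (n ∸ 1) C 2 → ∀ v →
  2 * (transmission G v + size G) ≡ (n + 2) * (n ∸ 1) →
  ∃ λ ℓ → ∃ λ a → ∃ λ b → IsPCParams n ℓ a b × G ≅ pathComplete n ℓ a b
transmission-tight⇒pathComplete {n} G conn 2≤n m≤C v tight rewrite transmission≡∑dist G v =
  layering⇒pathComplete {G = G} {d} (layering {G = G} {d} near far) e top (dist-levels G conn v wmax) (sparse wmax) 3≤e
  where
  d = dist G v
  root = dist-isRoot G conn v
  near = dist-edgesNear G conn v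
  far&sparse = levelSum-tight G root (dist∸1≤#below G conn v) near tight
  far = proj₁ far&sparse
  sparse = proj₂ far&sparse
  wmax = argmax d v (allFin n)
  e = d wmax
  top : ∀ w → d w ≤ e
  top = All.tabulate⁻ (f[xs]≤f[argmax] v (allFin n))
  1≤e : 1 ≤ e
  1≤e with w , w≢v ← other-vertex 2≤n v = ≤-trans (n≢0⇒n>0 (w≢v ∘ sym ∘ dist-zero G conn)) (top w)
  3≤e : 3 ≤ e
  3≤e with 3 ≤? e
  ... | yes 3≤e = 3≤e
  ... | no  3≰e = ⊥-elim (<-irrefl tight
        (levelSum-shallow G root (λ w → ≤-trans (top w) (s≤s⁻¹ (≰⇒> 3≰e))) (dist-levels G conn v wmax 1≤e) m≤C))

pathComplete-#below≤ : ∀ {n} ℓ a {K} → K ≤ suc ℓ → #below (pcLevel ℓ a ∘ toℕ {n}) K ≤ K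
pathComplete-#below≤ {n} ℓ a {K} K≤1+ℓ = ≤-trans (∑-mono-≤ {n} λ i →
    𝟙-mono (λ lvl<K → subst (_< K) (pcLevel-≤ℓ ℓ a (toℕ i) (s≤s⁻¹ (<-≤-trans lvl<K K≤1+ℓ))) lvl<K)
           (pcLevel ℓ a (toℕ i) <? K) (toℕ i <? K))
  (#below-toℕ {n} K)

pathComplete-tight : ∀ {n ℓ a b} (G : Graph n) → Connected G → IsPCParams n ℓ a b → G ≅ pathComplete n ℓ a b →
                     ∃ λ v → 2 * (transmission G v + size G) ≡ (n + 2) * (n ∸ 1)
pathComplete-tight {n} {ℓ} {a} {b} G conn (_ , _ , _ , refl) (f , g , gf , fg , adj-f) =
  v , ≤-antisym (transmission-upper G conn v) (begin
    (n + 2) * (n ∸ 1)            ≤⟨ levelSum-lower G root sparse (layering-nonEdgesFar {G = G} {φ} layer) ⟩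
    2 * (sum φ + size G)         ≤⟨ *-monoʳ-≤ 2 (+-monoˡ-≤ (size G) (∑-mono-≤ φ≤dist)) ⟩
    2 * (sum (dist G v) + size G) ≡⟨ cong (λ σ → 2 * (σ + size G)) (sym (transmission≡∑dist G v)) ⟩
    2 * (transmission G v + size G) ∎)
  where
  open ≤-Reasoning
  ψ = pcLevel ℓ a ∘ toℕ {n}
  φ = ψ ∘ f
  layer : IsLayering G φ
  layer = ≅-layering f g gf {G} {pathComplete n ℓ a b} {ψ} adj-f (pathComplete-layering n ℓ a b)
  v = g Fin.zero
  f≡zero : ∀ w → φ w ≡ 0 → f w ≡ Fin.zero
  f≡zero w φw≡0 = Fin.toℕ-injective (trans (sym (pcLevel-≤ℓ ℓ a (toℕ (f w)) (subst (_≤ ℓ) (sym φw≡0) z≤n))) φw≡0)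
  root : IsRoot φ v
  root = cong ψ (fg Fin.zero) , λ w φw≡0 → trans (sym (gf w)) (cong g (f≡zero w φw≡0))
  sparse : ∀ w → #below φ (φ w ∸ 1) ≤ φ w ∸ 1
  sparse w = ≤-trans (≤-reflexive (sym (∑-bijection f g fg gf (λ u → 𝟙 (ψ u <? φ w ∸ 1)))))
                     (pathComplete-#below≤ {n} ℓ a (∸-monoˡ-≤ 1 (pcLevel≤2+ℓ ℓ a (toℕ (f w)))))
  φ≤dist : ∀ w → φ w ≤ dist G v w
  φ≤dist = level≤dist G conn (layering-edgesNear {G = G} {φ} layer) (proj₁ root)

-- Rational form of the bound and remoteness

module _ {p q r : ℚᵘ} where

  p+r≤q⇒p≤q-r : p ℚᵘ.+ r ≤ᵘ q → p ≤ᵘ q ℚᵘ.- r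
  p+r≤q⇒p≤q-r p+r≤q = ℚᵘ.≤-respˡ-≃ (//-rightDividesʳ r p) (ℚᵘ.+-monoˡ-≤ (ℚᵘ.- r) p+r≤q)

  p≃q-r⇔p+r≃q : p ≃ᵘ q ℚᵘ.- r ⇔ p ℚᵘ.+ r ≃ᵘ q
  p≃q-r⇔p+r≃q = mk⇔ (λ p≃q-r → ℚᵘ.≃-trans (ℚᵘ.+-congˡ r p≃q-r) (//-rightDividesˡ r q))
                    (λ p+r≃q → ℚᵘ.≃-trans (ℚᵘ.≃-sym (//-rightDividesʳ r p)) (ℚᵘ.+-congˡ (ℚᵘ.- r) p+r≃q))

module _ (k : ℕ) where

  private
    K = suc k

    frac : ℕ → ℚᵘ
    frac a = mkℚᵘ (+ a) k

    half : ℕ → ℚᵘ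
    half t = mkℚᵘ (+ t) 1

    toℚᵘ-bound : ∀ t m → toℚᵘ ((+ t) / 2 - (+ m) / K) ≃ᵘ half t ℚᵘ.- frac m
    toℚᵘ-bound t m = ℚᵘ.≃-trans (toℚᵘ-homo-+ ((+ t) / 2) (ℚ.- ((+ m) / K)))
      (ℚᵘ.+-cong (toℚᵘ-fromℚᵘ (half t)) (ℚᵘ.≃-trans (toℚᵘ-homo‿- ((+ m) / K)) (ℚᵘ.-‿cong (toℚᵘ-fromℚᵘ (frac m)))))

    frac-+ : ∀ a b → frac a ℚᵘ.+ frac b ≃ᵘ frac (a + b)
    frac-+ a b = *≡* (begin
      (+ a ℤ.* + K ℤ.+ + b ℤ.* + K) ℤ.* + K ≡⟨ distrib (+ a) (+ b) (+ K) ⟩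
      (+ a ℤ.+ + b) ℤ.* (+ K ℤ.* + K)       ≡⟨ cong₂ ℤ._*_ (sym (ℤ.pos-+ a b)) (sym (ℤ.pos-* K K)) ⟩
      + (a + b) ℤ.* + (K * K)               ∎)
      where
      open ≡-Reasoning
      distrib : ∀ x y z → (x ℤ.* z ℤ.+ y ℤ.* z) ℤ.* z ≡ (x ℤ.+ y) ℤ.* (z ℤ.* z)
      distrib = ℤ-Solver.solve-∀

    cross : ∀ a t → + a ℤ.* + 2 ≡ + (2 * a) × + t ℤ.* + K ≡ + (t * K)
    cross a t = trans (sym (ℤ.pos-* a 2)) (cong +_ (*-comm a 2)) , sym (ℤ.pos-* t K)

    frac≤half : ∀ a t → 2 * a ≤ t * K → frac a ≤ᵘ half t
    frac≤half a t 2a≤tK = *≤* (subst₂ ℤ._≤_ (sym (proj₁ (cross a t))) (sym (proj₂ (cross a t))) (+≤+ 2a≤tK))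

    frac≃half⇔ : ∀ a t → frac a ≃ᵘ half t ⇔ 2 * a ≡ t * K
    frac≃half⇔ a t = mk⇔
      (λ eq → ℤ.+-injective (trans (sym (proj₁ (cross a t))) (trans (ℚᵘ.drop-*≡* eq) (proj₂ (cross a t)))))
      (λ eq → *≡* (trans (proj₁ (cross a t)) (trans (cong +_ eq) (sym (proj₂ (cross a t))))))

  frac≤bound : ∀ s m t → 2 * (s + m) ≤ t * K → (+ s) / K ≤ℚ (+ t) / 2 - (+ m) / K
  frac≤bound s m t le =
    toℚᵘ-cancel-≤ (ℚᵘ.≤-respˡ-≃ (ℚᵘ.≃-sym (toℚᵘ-fromℚᵘ (frac s))) (ℚᵘ.≤-respʳ-≃ (ℚᵘ.≃-sym (toℚᵘ-bound t m))
      (p+r≤q⇒p≤q-r {frac s} {half t} {frac m} (ℚᵘ.≤-respˡ-≃ (ℚᵘ.≃-sym (frac-+ s m)) (frac≤half (s + m) t le)))))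

  frac≡bound⇔ : ∀ s m t → (+ s) / K ≡ (+ t) / 2 - (+ m) / K ⇔ 2 * (s + m) ≡ t * K
  frac≡bound⇔ s m t = mk⇔
    (λ eq → Equivalence.to (frac≃half⇔ (s + m) t) (ℚᵘ.≃-trans (ℚᵘ.≃-sym (frac-+ s m)) (Equivalence.to shift
      (ℚᵘ.≃-trans (ℚᵘ.≃-sym (toℚᵘ-fromℚᵘ (frac s))) (ℚᵘ.≃-trans (toℚᵘ-cong eq) (toℚᵘ-bound t m))))))
    (λ eq → toℚᵘ-injective (ℚᵘ.≃-trans (toℚᵘ-fromℚᵘ (frac s)) (ℚᵘ.≃-trans (Equivalence.from shift
      (ℚᵘ.≃-trans (frac-+ s m) (Equivalence.from (frac≃half⇔ (s + m) t) eq))) (ℚᵘ.≃-sym (toℚᵘ-bound t m)))))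
    where
    shift = p≃q-r⇔p+r≃q {frac s} {half t} {frac m}

max₀ : List ℚ → ℚ
max₀ = foldr _⊔_ 0ℚ

max₀-lub : ∀ {q} xs → 0ℚ ≤ℚ q → All (_≤ℚ q) xs → max₀ xs ≤ℚ q
max₀-lub []       0≤q []           = 0≤q
max₀-lub (x ∷ xs) 0≤q (x≤q ∷ xs≤q) = ℚ.⊔-lub x≤q (max₀-lub xs 0≤q xs≤q)

max₀-ub : ∀ {x} xs → x ∈ xs → x ≤ℚ max₀ xs
max₀-ub (x ∷ xs) (here refl)  = ℚ.p≤p⊔q x (max₀ xs)
max₀-ub (x ∷ xs) (there x∈xs) = ℚ.≤-trans (max₀-ub xs x∈xs) (ℚ.p≤q⊔p x (max₀ xs))

max₀-attained : ∀ xs → xs ≢ [] → All (0ℚ ≤ℚ_) xs → max₀ xs ∈ xs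
max₀-attained []           []≢[] _             = ⊥-elim ([]≢[] refl)
max₀-attained (x ∷ [])     _     (0≤x ∷ [])    = here (ℚ.p≥q⇒p⊔q≡p 0≤x)
max₀-attained (x ∷ y ∷ ys) _     (_ ∷ nonneg) with ℚ.⊔-sel x (max₀ (y ∷ ys))
... | inj₁ x⊔≡x    = here x⊔≡x
... | inj₂ x⊔≡rest = there (subst (_∈ y ∷ ys) (sym x⊔≡rest) (max₀-attained (y ∷ ys) (λ ()) nonneg))

module _ {n : ℕ} (G : Graph n) where

  private
    avgDists : List ℚ
    avgDists = Data.List.map (avgDist G) (allFin n)

  avgDist-nonNeg : ∀ v → 0ℚ ≤ℚ avgDist G v
  avgDist-nonNeg v = ℚ.nonNegative⁻¹ _ {{ℚ.normalize-nonNeg (transmission G v) (suc (n ∸ 2))}}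

  avgDist≤remoteness : ∀ v → avgDist G v ≤ℚ remoteness G
  avgDist≤remoteness v = max₀-ub avgDists (∈-map⁺ (avgDist G) (∈-allFin v))

  remoteness-lub : ∀ {q} → Fin n → (∀ v → avgDist G v ≤ℚ q) → remoteness G ≤ℚ q
  remoteness-lub v bound = max₀-lub avgDists (ℚ.≤-trans (avgDist-nonNeg v) (bound v)) (All.map⁺ (All.tabulate⁺ bound))

  remoteness-attained : Fin n → ∃ λ v → remoteness G ≡ avgDist G v
  remoteness-attained v = proj₁ found , proj₂ (proj₂ found)
    where
    nonEmpty : avgDists ≢ []
    nonEmpty avgDists≡[] = ¬Any[] (subst (avgDist G v ∈_) avgDists≡[] (∈-map⁺ (avgDist G) (∈-allFin v)))
    found : ∃ λ w → w ∈ allFin n × remoteness G ≡ avgDist G w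
    found = ∈-map⁻ (avgDist G) (max₀-attained avgDists nonEmpty (All.map⁺ (All.tabulate⁺ avgDist-nonNeg)))

IsPK1-intro : ∀ {n} {G : Graph n} → (∃ λ ℓ → ∃ λ a → ∃ λ b → IsPCParams n ℓ a b × G ≅ pathComplete n ℓ a b) →
              IsPK1 n (size G) G
IsPK1-intro {n} {G} (ℓ , a , b , params , iso) =
  ℓ , a , b , params , ≤-reflexive size≡ , (λ _ _ _ _ → ≤-trans (≤-reflexive (sym size≡))) , iso
  where
  size≡ : size G ≡ size (pathComplete n ℓ a b)
  size≡ = ≅⇒size≡ {G = G} {pathComplete n ℓ a b} iso

mainTheorem4 : (n m : ℕ) (G : Graph n) → 2 ≤ n → Connected G → size G ≡ m →
    n ∸ 1 ≤ m → m ≤ (n ∸ 1) C 2 →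
    (remoteness G ≤ℚ ((+ (n + 2)) / 2 - (+ m) / suc (n ∸ 2) )) ×
    ((remoteness G ≡ ((+ (n + 2)) / 2 - (+ m) / suc (n ∸ 2))) ⇔ IsPK1 n m G)
mainTheorem4 0       _ _ ()         _ _ _ _
mainTheorem4 1       _ _ (s≤s ())   _ _ _ _
-- The bound keeps the
-- statement's suc (n ∸ 2) and vertices are bound by let: any syntactic mismatch inside a rational
-- makes Agda unfold the gcd in _/_ on open terms.
mainTheorem4 n@(suc (suc _)) _ G 2≤n conn refl _ m≤C = upper , mk⇔ tight⇒PK1 PK1⇒tight
  where
  bound : ℚ
  bound = (+ (n + 2)) / 2 - (+ size G) / suc (n ∸ 2)

  avg≤bound : ∀ v → avgDist G v ≤ℚ bound
  avg≤bound v = frac≤bound (n ∸ 2) (transmission G v) (size G) (n + 2) (transmission-upper G conn v)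

  avg≡bound⇔ : ∀ v → avgDist G v ≡ bound ⇔ 2 * (transmission G v + size G) ≡ (n + 2) * (n ∸ 1)
  avg≡bound⇔ v = frac≡bound⇔ (n ∸ 2) (transmission G v) (size G) (n + 2)

  upper : remoteness G ≤ℚ bound
  upper = remoteness-lub G Fin.zero avg≤bound

  tight⇒PK1 : remoteness G ≡ bound → IsPK1 n (size G) G
  tight⇒PK1 ρ≡bound =
    let (v , ρ≡avg) = remoteness-attained G Fin.zero
    in IsPK1-intro {n} {G} (transmission-tight⇒pathComplete G conn 2≤n m≤C v
                     (Equivalence.to (avg≡bound⇔ v) (trans (sym ρ≡avg) ρ≡bound)))

  PK1⇒tight : IsPK1 n (size G) G → remoteness G ≡ bound
  PK1⇒tight (_ , _ , _ , params , _ , _ , iso) =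
    let (v , tight) = pathComplete-tight G conn params iso
    in ℚ.≤-antisym upper (ℚ.≤-trans (ℚ.≤-reflexive (sym (Equivalence.from (avg≡bound⇔ v) tight)))
                                    (avgDist≤remoteness G v))
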